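{- In the instantiation of a template-acyclic directed parametric graph template, consider an instance $u'$ of a template-graph vertex $u$ and two instances $v'$ and $v''$ of the same template-graph vertex $v$, where either $T(u)=T(v)$ or $T(v)$ is an ancestor of $T(u)$. If there is a path from $u'$ to $v'$ and a path from $u'$ to $v''$, then $v'=v''$.
   Context: A parametric graph template $\mathcal{G}=(G,\mathcal{T},\mathcal{P})$ consists of a directed template graph $G=(V,E)$, a list of templates $T_0,\dots,T_{k-1}$ with $\emptyset\neq T_i\subseteq V$, and positive integer parameters $P_0,\dots,P_{k-1}$. For $i\neq j$, either $T_i\cap T_j=\emptyset$, $T_i\subsetneq T_j$, or $T_j\subsetneq T_i$; the root template is $T_0=V$ with $P_0=1$. Inclusion induces a rooted template tree. For $v\in V$, $T(v)$ is the smallest template containing $v$. No skipping: for every edge $(u,v)$ with $T(u)\neq T(v)$, one of $T(u),T(v)$ is the parent of the other. The instantiation: while more than one template remains, pick a leaf template $T_i\neq T_0$; replace each $v\in T_i$ (in $V$ and every template containing it) by $P_i$ copies $v_1,\dots,v_{P_i}$ (instances of $v$); replace each edge $(u,v)$ with both endpoints in $T_i$ by $(u_j,v_j)$, each edge $(u,v)$ with only $u\in T_i$ by $(u_j,v)$, and symmetrically, $j=1,\dots,P_i$; delete $T_i,P_i$. Instances are transitive. A template-cycle is a directed path $p_1,\dots,p_r$ in $G$ with indices $a<b<c$ such that $T(p_a)=T(p_c)\neq T(p_b)$; $\mathcal{G}$ is template-acyclic if it has none. -}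

module Defs where

open import Data.Nat using (ℕ; zero; suc; _≤_)
open import Data.Fin using (Fin; zero; suc; inject₁; _<_)
open import Data.Fin.Subset using (Subset; _∈_; _⊆_; _⊂_; _∩_; ⊤; Nonempty; Empty)
open import Data.Product using (Σ; ∃; _×_; _,_)
open import Data.Sum using (_⊎_)
open import Relation.Nullary using (¬_)
open import Relation.Binary.PropositionalEquality using (_≡_; _≢_)
open import Relation.Binary.Construct.Closure.ReflexiveTransitive using (Star)

module _ {n k : ℕ} (T : Fin k → Subset n) where

  -- T i is T(v): the smallest template containing v
  IsT : Fin k → Fin n → Set
  IsT i v = v ∈ T i × (∀ j → v ∈ T j → T i ⊆ T j)

  IsParent : Fin k → Fin k → Set
  IsParent i j = T i ⊂ T j × (∀ l → T i ⊂ T l → ¬ (T l ⊂ T j))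

record PGT : Set₁ where
  field
    n        : ℕ
    k        : ℕ
    E        : Fin n → Fin n → Set
    T        : Fin (suc k) → Subset n
    P        : Fin (suc k) → ℕ
    nonempty : ∀ i → Nonempty (T i)
    laminar  : ∀ i j → i ≢ j → Empty (T i ∩ T j) ⊎ (T i ⊂ T j ⊎ T j ⊂ T i)
    rootT    : T zero ≡ ⊤
    rootP    : P zero ≡ 1
    posP     : ∀ i → 1 ≤ P i
    noSkip   : ∀ u v i j → E u v → IsT T i u → IsT T j v → i ≢ j →
               IsParent T i j ⊎ IsParent T j i

module _ (𝒢 : PGT) where
  open PGT 𝒢

  record GPath : Set where
    field
      len   : ℕ
      vtx   : Fin (suc len) → Fin n
      edges : (i : Fin len) → E (vtx (inject₁ i)) (vtx (suc i))

  TemplateCycle : Set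
  TemplateCycle =
    Σ GPath λ p → let open GPath p in
    Σ (Fin (suc len)) λ a → Σ (Fin (suc len)) λ b → Σ (Fin (suc len)) λ c →
    a < b × b < c ×
    Σ (Fin (suc k)) λ ia → Σ (Fin (suc k)) λ ib → Σ (Fin (suc k)) λ ic →
    IsT T ia (vtx a) × IsT T ib (vtx b) × IsT T ic (vtx c) ×
    ia ≡ ic × ia ≢ ib

  TemplateAcyclic : Set
  TemplateAcyclic = ¬ TemplateCycle

  -- Unfolding the iterative
  -- procedure, a vertex of the instantiated graph is an instance of a
  -- template vertex v together with, for every template T i containing
  -- v, the copy index (in Fin (P i)) chosen when T i was expanded.
  -- We carry an index for every template and identify instances that
  -- agree on all templates containing the vertex (setoid equality).

  record Inst : Set where
    constructor inst
    field
      base : Fin n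
      idx  : (i : Fin (suc k)) → Fin (P i)

  open Inst public

  _≈I_ : Inst → Inst → Set
  x ≈I y = base x ≡ base y × (∀ i → base x ∈ T i → idx x i ≡ idx y i)

  IEdge : Inst → Inst → Set
  IEdge x y = E (base x) (base y) ×
              (∀ i → base x ∈ T i → base y ∈ T i → idx x i ≡ idx y i)

  IPath : Inst → Inst → Set
  IPath = Star IEdge

{-# OPTIONS --safe #-}
module Submission where

-- Along an instance path, an edge between two vertices of T a keeps the copy index of every
-- template containing T a. A path from inside T(v) to a vertex of level T(v) never leaves T(v):
-- by no skipping, an edge out of T(v) starts at a vertex of level exactly T(v), and the return
-- to v would close a template-cycle. Hence v′ and v″ both agree with u′ on every template
-- containing v.

open import Defs
open import Data.Nat using (ℕ; zero; suc; z≤n; s≤s)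
open import Data.Nat.Induction using (<-wellFounded)
open import Data.Fin using (Fin; zero; suc; fromℕ; inject₁; _≟_)
open import Data.Fin.Properties using (any?)
open import Data.Fin.Subset using (_⊂_; _⊆_; _∈_; _∉_; ∣_∣)
open import Data.Fin.Subset.Properties using (_⊆?_; _∈?_; p⊂q⇒∣p∣<∣q∣; x∈p∩q⁺; ⊆-refl; ∈⊤)
open import Data.Sum using (_⊎_; inj₁; inj₂)
open import Data.Product using (∃; _,_; proj₁; proj₂)
open import Data.Empty using (⊥-elim)
open import Function using (_on_)
open import Induction.WellFounded using (WellFounded; Acc; acc; module Subrelation)
open import Relation.Binary.Construct.On as On using ()
open import Relation.Nullary using (yes; no)
open import Relation.Nullary.Decidable using (_×-dec_; ¬?; decidable-stable)
open import Relation.Binary.PropositionalEquality using (_≡_; _≢_; refl; sym; trans; subst)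
open import Relation.Binary.Construct.Closure.ReflexiveTransitive using (Star; ε; _◅_; gmap)

module _ (𝒢 : PGT) where
  open PGT 𝒢

  overlapping⇒nested : ∀ {x i j} → x ∈ T i → x ∈ T j →
                       i ≡ j ⊎ T i ⊂ T j ⊎ T j ⊂ T i
  overlapping⇒nested {x} {i} {j} x∈i x∈j with i ≟ j
  ... | yes i≡j = inj₁ i≡j
  ... | no i≢j with laminar i j i≢j
  ...   | inj₁ disjoint = ⊥-elim (disjoint (x , x∈p∩q⁺ (x∈i , x∈j)))
  ...   | inj₂ nested   = inj₂ nested

  IsT⇒≡⊎⊂ : ∀ {x i j} → IsT T i x → x ∈ T j → i ≡ j ⊎ T i ⊂ T j
  IsT⇒≡⊎⊂ (x∈i , smallest) x∈j with overlapping⇒nested x∈i x∈j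
  ... | inj₁ i≡j                        = inj₁ i≡j
  ... | inj₂ (inj₁ i⊂j)                 = inj₂ i⊂j
  ... | inj₂ (inj₂ (_ , y , y∈i , y∉j)) = ⊥-elim (y∉j (smallest _ x∈j y∈i))

  ∈-≡⊎⊂ : ∀ {x i j} → x ∈ T i → i ≡ j ⊎ T i ⊂ T j → x ∈ T j
  ∈-≡⊎⊂ x∈i (inj₁ refl)       = x∈i
  ∈-≡⊎⊂ x∈i (inj₂ (i⊆j , _)) = i⊆j x∈i

  ⊂-wellFounded : WellFounded (_⊂_ on T)
  ⊂-wellFounded = Subrelation.wellFounded p⊂q⇒∣p∣<∣q∣
                    (On.wellFounded (λ i → ∣ T i ∣) <-wellFounded)

  smallestTemplate : ∀ x → ∃ λ i → IsT T i x
  smallestTemplate x = below (⊂-wellFounded zero) (subst (x ∈_) (sym rootT) ∈⊤)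
    where
    below : ∀ {i} → Acc (_⊂_ on T) i → x ∈ T i → ∃ λ j → IsT T j x
    below {i} (acc rs) x∈i with any? (λ j → x ∈? T j ×-dec ¬? (T i ⊆? T j))
    ... | no ¬larger = i , x∈i , λ j x∈j →
            decidable-stable (T i ⊆? T j) (λ i⊈j → ¬larger (j , x∈j , i⊈j))
    ... | yes (j , x∈j , i⊈j) with overlapping⇒nested x∈i x∈j
    ...   | inj₁ refl         = ⊥-elim (i⊈j ⊆-refl)
    ...   | inj₂ (inj₁ i⊂j)   = ⊥-elim (i⊈j (proj₁ i⊂j))
    ...   | inj₂ (inj₂ j⊂i)   = below (rs j⊂i) x∈j

  -- By no skipping the edge climbs at most to the parent of T iw, which lies inside T a.
  edge-from-⊂⇒target∈ : ∀ {w y a iw} → E w y → IsT T iw w → T iw ⊂ T a → y ∈ T a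
  edge-from-⊂⇒target∈ {w} {y} {a} {iw} e isw@(w∈iw , _) iw⊂a@(iw⊆a , _)
    with smallestTemplate y
  ... | iy , isy@(y∈iy , _) with iw ≟ iy
  ...   | yes refl = iw⊆a y∈iy
  ...   | no iw≢iy with noSkip w y iw iy e isw isy iw≢iy
  ...     | inj₂ ((iy⊆iw , _) , _) = iw⊆a (iy⊆iw y∈iy)
  ...     | inj₁ (iw⊂iy@(iw⊆iy , _) , minimal)
            with overlapping⇒nested (iw⊆a w∈iw) (iw⊆iy w∈iw)
  ...       | inj₁ refl               = y∈iy
  ...       | inj₂ (inj₁ a⊂iy)        = ⊥-elim (minimal a iw⊂a a⊂iy)
  ...       | inj₂ (inj₂ (iy⊆a , _))  = iy⊆a y∈iy

  leavingEdge⇒IsT : ∀ {w y a} → E w y → w ∈ T a → y ∉ T a → IsT T a w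
  leavingEdge⇒IsT {w} e w∈a y∉a with smallestTemplate w
  ... | iw , isw with IsT⇒≡⊎⊂ isw w∈a
  ...   | inj₁ refl = isw
  ...   | inj₂ iw⊂a = ⊥-elim (y∉a (edge-from-⊂⇒target∈ e isw iw⊂a))

  length : ∀ {x y} → Star E x y → ℕ
  length ε       = 0
  length (_ ◅ s) = suc (length s)

  vertex : ∀ {x y} (s : Star E x y) → Fin (suc (length s)) → Fin n
  vertex {x} _ zero    = x
  vertex (_ ◅ s) (suc i) = vertex s i

  vertex-last : ∀ {x y} (s : Star E x y) → vertex s (fromℕ (length s)) ≡ y
  vertex-last ε       = refl
  vertex-last (_ ◅ s) = vertex-last s

  edge : ∀ {x y} (s : Star E x y) (i : Fin (length s)) →
         E (vertex s (inject₁ i)) (vertex s (suc i))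
  edge (e ◅ _) zero    = e
  edge (_ ◅ s) (suc i) = edge s i

  Star⇒GPath : ∀ {x y} → Star E x y → GPath 𝒢
  Star⇒GPath s = record { len = length s ; vtx = vertex s ; edges = edge s }

  templateCycle : ∀ {w y y′ z a b} → E w y → E y y′ → Star E y′ z →
                  IsT T a w → IsT T b y → IsT T a z → a ≢ b → TemplateCycle 𝒢
  templateCycle {a = a} {b} e e′ s isw isy isz a≢b =
    Star⇒GPath p , zero , suc zero , fromℕ (length p) , s≤s z≤n , s≤s (s≤s z≤n) ,
    a , b , a , isw , isy , subst (IsT T a) (sym (vertex-last p)) isz , refl , a≢b
    where p = e ◅ e′ ◅ s

  module _ (acyclic : TemplateAcyclic 𝒢) where

    -- An exit from T a followed by a return to a vertex of level a is a template-cycle.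
    next∈T : ∀ {w y z a} → E w y → Star E y z → w ∈ T a → IsT T a z → y ∈ T a
    next∈T {y = y} {a = a} e s w∈a isz with y ∈? T a
    ... | yes y∈a = y∈a
    ... | no y∉a with s | smallestTemplate y
    ...   | ε       | _              = ⊥-elim (y∉a (proj₁ isz))
    ...   | e′ ◅ s′ | b , isy@(y∈b , _) =
            ⊥-elim (acyclic (templateCycle e e′ s′ (leavingEdge⇒IsT e w∈a y∉a) isy isz
                                           λ { refl → y∉a y∈b }))

    idx-preserved : ∀ {x z a i} → IPath 𝒢 x z → base x ∈ T a → IsT T a (base z) →
                    T a ⊆ T i → idx x i ≡ idx z i
    idx-preserved ε _ _ _ = refl
    idx-preserved {a = a} (_◅_ {j = y} e s) x∈a isz a⊆i =
      trans (proj₂ e _ (a⊆i x∈a) (a⊆i y∈a)) (idx-preserved s y∈a isz a⊆i)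
      where
      y∈a : base y ∈ T a
      y∈a = next∈T (proj₁ e) (gmap base proj₁ s) x∈a isz

corollary2 : (𝒢 : PGT) → TemplateAcyclic 𝒢 →
    (u v : Fin (PGT.n 𝒢)) (iu iv : Fin (suc (PGT.k 𝒢))) →
    IsT (PGT.T 𝒢) iu u → IsT (PGT.T 𝒢) iv v →
    (iu ≡ iv ⊎ PGT.T 𝒢 iu ⊂ PGT.T 𝒢 iv) →
    (u′ v′ v″ : Inst 𝒢) →
    base u′ ≡ u → base v′ ≡ v → base v″ ≡ v →
    IPath 𝒢 u′ v′ → IPath 𝒢 u′ v″ →
    _≈I_ 𝒢 v′ v″
corollary2 𝒢 acyclic _ _ _ iv isu isv iu≤iv u′ _ _ refl refl v″≡v′ p′ p″ =
  sym v″≡v′ , λ i v′∈i →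
    let iv⊆i = proj₂ isv i v′∈i in
    trans (sym (idx-preserved 𝒢 acyclic p′ u′∈iv isv iv⊆i))
          (idx-preserved 𝒢 acyclic p″ u′∈iv (subst (IsT T iv) (sym v″≡v′) isv) iv⊆i)
  where
  open PGT 𝒢
  u′∈iv : base u′ ∈ T iv
  u′∈iv = ∈-≡⊎⊂ 𝒢 (proj₁ isu) iu≤iv
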